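{- For all integers $n,j$ with $1\le j\le n$, $$\sum_{l=0}^{j-1}(-1)^{j-l-1}\binom{n-l-1}{n-j}\binom{n}{l}\frac{1}{(n-l)^2} = \frac{(H_n-H_{n-j})^2}{2}+\frac{H_n^{(2)}-H_{n-j}^{(2)}}{2}.$$
   Context: $H_m^{(r)}=\sum_{i=1}^m i^{ -r}$, $H_m=H_m^{(1)}$, with $H_0^{(r)}=0$. -}

module Defs where

open import Data.Nat as ℕ using (ℕ; zero; suc; _∸_; _^_)
open import Data.Nat.Combinatorics using (_C_)
open import Data.Integer using (+_)
open import Data.Rational using (ℚ; 0ℚ; _+_; _*_; -_; _/_)

-- 1 / k as a rational; the value at k = 0 is a junk value 0 (never used below
-- in the statement, since all denominators there are ≥ 1).
recip : ℕ → ℚ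
recip zero    = 0ℚ
recip (suc k) = (+ 1) / suc k

ι : ℕ → ℚ
ι k = (+ k) / 1

H^ : ℕ → ℕ → ℚ
H^ r zero    = 0ℚ
H^ r (suc m) = H^ r m + recip (suc m ^ r)

H : ℕ → ℚ
H = H^ 1

sgn : ℕ → ℚ
sgn zero    = (+ 1) / 1
sgn (suc k) = - sgn k

Σ< : ℕ → (ℕ → ℚ) → ℚ
Σ< zero    f = 0ℚ
Σ< (suc j) f = Σ< j f + f j

lhs : ℕ → ℕ → ℚ
lhs n j = Σ< j (λ l → sgn (j ∸ l ∸ 1) * ι ((n ∸ l ∸ 1) C (n ∸ j)) * ι (n C l)
                       * recip ((n ∸ l) ^ 2))

rhs : ℕ → ℕ → ℚ
rhs n j = (H n + - H (n ∸ j)) * (H n + - H (n ∸ j)) * recip 2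
          + (H^ 2 n + - H^ 2 (n ∸ j)) * recip 2

-- For a weight w let T w m j = Σ_{i<j} (-1)^i C(i+m,m) C(j+m,i+m+1) w(i+m+1).  Reversing the order
-- of summation turns the left-hand side into T (1/k²) (n-j) j.  Pascal's rule followed by the
-- absorption identity gives
--   T w m (j+1) = T w m j + 1/(j+m+1) · T (k ↦ k w(k)) m (j+1),
-- the recurrence h_r(x_1..x_{j+1}) = h_r(x_1..x_j) + x_{j+1} h_{r-1}(x_1..x_{j+1}) of the complete
-- homogeneous symmetric polynomials in x_i = 1/(m+i).  Since T 1 m (j+1) = 1 (an alternating
-- binomial sum), T (1/k) m j = h₁ = H_{j+m} - H_m and T (1/k²) m j = h₂ = (p₁² + p₂)/2, which is
-- the right-hand side.
module Submission where

open import Defs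
open import Data.Nat using (ℕ; _≤_)
open import Relation.Binary.PropositionalEquality using (_≡_)

open import Level using (0ℓ)
open import Data.Nat as ℕ using (zero; suc; _∸_; _^_; _<_; _!; s≤s)
import Data.Nat.Properties as ℕₚ
import Data.Nat.Tactic.RingSolver as ℕ-Solver
open import Data.Nat.Combinatorics
  using (_C_; nCk+nC[k+1]≡[n+1]C[k+1]; k>n⇒nCk≡0; nCn≡1; nCk≡nC[n∸k]; nCk≡n!/k![n-k]!; k![n∸k]!∣n!)
open import Data.Nat.DivMod using (m/n*n≡m)
open import Data.Product using (_,_)
open import Function using (_∘_)
open import Data.Integer as ℤ using (+_)
import Data.Integer.Properties as ℤₚ
open import Data.Rational using (ℚ; 0ℚ; 1ℚ; _+_; _*_; -_; toℚᵘ)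
import Data.Rational.Properties as ℚₚ
open import Data.Rational.Unnormalised as ℚᵘ using (mkℚᵘ; *≡*; _≃_)
import Data.Rational.Unnormalised.Properties as ℚᵘₚ
open import Relation.Binary.PropositionalEquality using (refl; sym; trans; cong; cong₂; subst; module ≡-Reasoning)
open import Relation.Nullary.Decidable using (yes; no; dec⇒maybe)
open import Tactic.RingSolver using (solve-∀)
import Tactic.RingSolver.Core.AlmostCommutativeRing as ACR

open ≡-Reasoning

ℚ-ring : ACR.AlmostCommutativeRing 0ℓ 0ℓ
ℚ-ring = ACR.fromCommutativeRing ℚₚ.+-*-commutativeRing (λ x → dec⇒maybe (0ℚ ℚₚ.≟ x))

toℚᵘ-ι : ∀ k → toℚᵘ (ι k) ≃ mkℚᵘ (+ k) 0
toℚᵘ-ι k = ℚₚ.toℚᵘ-fromℚᵘ (mkℚᵘ (+ k) 0)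

≡-via-ℚᵘ : ∀ {p q} u → toℚᵘ p ≃ u → toℚᵘ q ≃ u → p ≡ q
≡-via-ℚᵘ u p≃u q≃u = ℚₚ.toℚᵘ-injective (ℚᵘₚ.≃-trans p≃u (ℚᵘₚ.≃-sym q≃u))

ι-+ : ∀ a b → ι (a ℕ.+ b) ≡ ι a + ι b
ι-+ a b = ≡-via-ℚᵘ (mkℚᵘ (+ a) 0 ℚᵘ.+ mkℚᵘ (+ b) 0)
  (ℚᵘₚ.≃-trans (toℚᵘ-ι (a ℕ.+ b)) (*≡* (cong (ℤ._* + 1) (trans (ℤₚ.pos-+ a b)
    (sym (cong₂ ℤ._+_ (ℤₚ.*-identityʳ (+ a)) (ℤₚ.*-identityʳ (+ b))))))))
  (ℚᵘₚ.≃-trans (ℚₚ.toℚᵘ-homo-+ (ι a) (ι b)) (ℚᵘₚ.+-cong (toℚᵘ-ι a) (toℚᵘ-ι b)))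

ι-* : ∀ a b → ι (a ℕ.* b) ≡ ι a * ι b
ι-* a b = ≡-via-ℚᵘ (mkℚᵘ (+ a) 0 ℚᵘ.* mkℚᵘ (+ b) 0)
  (ℚᵘₚ.≃-trans (toℚᵘ-ι (a ℕ.* b)) (*≡* (cong (ℤ._* + 1) (ℤₚ.pos-* a b))))
  (ℚᵘₚ.≃-trans (ℚₚ.toℚᵘ-homo-* (ι a) (ι b)) (ℚᵘₚ.*-cong (toℚᵘ-ι a) (toℚᵘ-ι b)))

recip-inverseˡ : ∀ k → recip (suc k) * ι (suc k) ≡ 1ℚ
recip-inverseˡ k = ≡-via-ℚᵘ (mkℚᵘ (+ 1) k ℚᵘ.* mkℚᵘ (+ suc k) 0)
  (ℚᵘₚ.≃-trans (ℚₚ.toℚᵘ-homo-* (recip (suc k)) (ι (suc k)))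
               (ℚᵘₚ.*-cong (ℚₚ.toℚᵘ-fromℚᵘ (mkℚᵘ (+ 1) k)) (toℚᵘ-ι (suc k))))
  (ℚᵘₚ.≃-sym (*≡* (trans (ℤₚ.*-identityʳ _) (trans (ℤₚ.*-identityˡ _)
    (sym (trans (ℤₚ.*-identityˡ _) (cong +_ (ℕₚ.*-identityʳ (suc k)))))))))

recip-inverseʳ : ∀ k → ι (suc k) * recip (suc k) ≡ 1ℚ
recip-inverseʳ k = trans (ℚₚ.*-comm (ι (suc k)) (recip (suc k))) (recip-inverseˡ k)

recip-unique : ∀ {x} k → x * ι (suc k) ≡ 1ℚ → x ≡ recip (suc k)
recip-unique {x} k x*k≡1 = begin
  x                                ≡⟨ ℚₚ.*-identityʳ x ⟨
  x * 1ℚ                           ≡⟨ cong (x *_) (recip-inverseʳ k) ⟨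
  x * (ι (suc k) * recip (suc k))  ≡⟨ ℚₚ.*-assoc x (ι (suc k)) (recip (suc k)) ⟨
  x * ι (suc k) * recip (suc k)    ≡⟨ cong (_* recip (suc k)) x*k≡1 ⟩
  1ℚ * recip (suc k)               ≡⟨ ℚₚ.*-identityˡ (recip (suc k)) ⟩
  recip (suc k)                    ∎

recip-* : ∀ a b → recip (suc a ℕ.* suc b) ≡ recip (suc a) * recip (suc b)
recip-* a b = sym (recip-unique (b ℕ.+ a ℕ.* suc b) (begin
  ra * rb * ι (suc a ℕ.* suc b)      ≡⟨ cong (ra * rb *_) (ι-* (suc a) (suc b)) ⟩
  ra * rb * (ι (suc a) * ι (suc b))  ≡⟨ regroup ra rb (ι (suc a)) (ι (suc b)) ⟩
  ra * ι (suc a) * (rb * ι (suc b))  ≡⟨ cong₂ _*_ (recip-inverseˡ a) (recip-inverseˡ b) ⟩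
  1ℚ * 1ℚ                            ≡⟨ ℚₚ.*-identityʳ 1ℚ ⟩
  1ℚ                                 ∎))
  where
  ra = recip (suc a)
  rb = recip (suc b)
  regroup : ∀ x y u v → x * y * (u * v) ≡ x * u * (y * v)
  regroup = solve-∀ ℚ-ring

recip-square : ∀ k → recip (suc k ^ 2) ≡ recip (suc k) * recip (suc k)
recip-square k = trans (cong (λ e → recip (suc k ℕ.* e)) (ℕₚ.*-identityʳ (suc k))) (recip-* k k)

H-suc : ∀ N → H (suc N) ≡ H N + recip (suc N)
H-suc N = cong (λ e → H N + recip e) (ℕₚ.*-identityʳ (suc N))

H²-suc : ∀ N → H^ 2 (suc N) ≡ H^ 2 N + recip (suc N) * recip (suc N)
H²-suc N = cong (_+_ (H^ 2 N)) (recip-square N)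

Σ<-cong : ∀ j {f g : ℕ → ℚ} → (∀ i → i < j → f i ≡ g i) → Σ< j f ≡ Σ< j g
Σ<-cong zero    f≡g = refl
Σ<-cong (suc j) f≡g =
  cong₂ _+_ (Σ<-cong j (λ i i<j → f≡g i (ℕₚ.m<n⇒m<1+n i<j))) (f≡g j (ℕₚ.n<1+n j))

Σ<-+ : ∀ j (f g : ℕ → ℚ) → Σ< j (λ i → f i + g i) ≡ Σ< j f + Σ< j g
Σ<-+ zero    f g = refl
Σ<-+ (suc j) f g =
  trans (cong (_+ (f j + g j)) (Σ<-+ j f g)) (interchange (Σ< j f) (Σ< j g) (f j) (g j))
  where
  interchange : ∀ a b c d → a + b + (c + d) ≡ a + c + (b + d)
  interchange = solve-∀ ℚ-ring

Σ<-*ˡ : ∀ j c (f : ℕ → ℚ) → Σ< j (λ i → c * f i) ≡ c * Σ< j f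
Σ<-*ˡ zero    c f = sym (ℚₚ.*-zeroʳ c)
Σ<-*ˡ (suc j) c f =
  trans (cong (_+ (c * f j)) (Σ<-*ˡ j c f)) (sym (ℚₚ.*-distribˡ-+ c (Σ< j f) (f j)))

Σ<-suc-first : ∀ j (f : ℕ → ℚ) → Σ< (suc j) f ≡ f 0 + Σ< j (λ i → f (suc i))
Σ<-suc-first zero    f = trans (ℚₚ.+-identityˡ (f 0)) (sym (ℚₚ.+-identityʳ (f 0)))
Σ<-suc-first (suc j) f = trans (cong (_+ f (suc j)) (Σ<-suc-first j f)) (ℚₚ.+-assoc (f 0) _ _)

Σ<-reverse : ∀ j (f : ℕ → ℚ) → Σ< j f ≡ Σ< j (λ i → f (j ∸ suc i))
Σ<-reverse zero    f = refl
Σ<-reverse (suc j) f = begin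
  Σ< j f + f j                          ≡⟨ ℚₚ.+-comm (Σ< j f) (f j) ⟩
  f j + Σ< j f                          ≡⟨ cong (_+_ (f j)) (Σ<-reverse j f) ⟩
  f j + Σ< j (λ i → f (j ∸ suc i))      ≡⟨ Σ<-suc-first j (λ i → f (suc j ∸ suc i)) ⟨
  Σ< (suc j) (λ i → f (suc j ∸ suc i))  ∎

nCk*[k!*[n∸k]!]≡n! : ∀ {n k} → k ≤ n → (n C k) ℕ.* (k ! ℕ.* (n ∸ k) !) ≡ n !
nCk*[k!*[n∸k]!]≡n! {n} {k} k≤n = trans (cong (ℕ._* (k ! ℕ.* (n ∸ k) !)) (nCk≡n!/k![n-k]! k≤n))
                                       (m/n*n≡m {{k ℕₚ.!* (n ∸ k) !≢0}} (k![n∸k]!∣n! k≤n))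

[m+n]Cm*[m!*n!]≡[m+n]! : ∀ m n → ((m ℕ.+ n) C m) ℕ.* (m ! ℕ.* n !) ≡ (m ℕ.+ n) !
[m+n]Cm*[m!*n!]≡[m+n]! m n = begin
  ((m ℕ.+ n) C m) ℕ.* (m ! ℕ.* n !)
    ≡⟨ cong (λ k → ((m ℕ.+ n) C m) ℕ.* (m ! ℕ.* k !)) (ℕₚ.m+n∸m≡n m n) ⟨
  ((m ℕ.+ n) C m) ℕ.* (m ! ℕ.* (m ℕ.+ n ∸ m) !)
    ≡⟨ nCk*[k!*[n∸k]!]≡n! (ℕₚ.m≤m+n m n) ⟩
  (m ℕ.+ n) !
    ∎

[m+n]Cn*[m!*n!]≡[m+n]! : ∀ m n → ((m ℕ.+ n) C n) ℕ.* (m ! ℕ.* n !) ≡ (m ℕ.+ n) !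
[m+n]Cn*[m!*n!]≡[m+n]! m n = begin
  ((m ℕ.+ n) C n) ℕ.* (m ! ℕ.* n !)
    ≡⟨ cong₂ ℕ._*_ (cong (_C n) (ℕₚ.+-comm m n)) (ℕₚ.*-comm (m !) (n !)) ⟩
  ((n ℕ.+ m) C n) ℕ.* (n ! ℕ.* m !)  ≡⟨ [m+n]Cm*[m!*n!]≡[m+n]! n m ⟩
  (n ℕ.+ m) !                        ≡⟨ cong _! (ℕₚ.+-comm n m) ⟩
  (m ℕ.+ n) !                        ∎

[1+k]*[1+n]C[1+k]≡[1+n]*nCk : ∀ n k → suc k ℕ.* (suc n C suc k) ≡ suc n ℕ.* (n C k)
[1+k]*[1+n]C[1+k]≡[1+n]*nCk n k with k ℕₚ.≤? n
... | no k≰n = begin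
  suc k ℕ.* (suc n C suc k)  ≡⟨ cong (suc k ℕ.*_) (k>n⇒nCk≡0 (s≤s k>n)) ⟩
  suc k ℕ.* 0                ≡⟨ ℕₚ.*-zeroʳ (suc k) ⟩
  0                          ≡⟨ ℕₚ.*-zeroʳ (suc n) ⟨
  suc n ℕ.* 0                ≡⟨ cong (suc n ℕ.*_) (k>n⇒nCk≡0 k>n) ⟨
  suc n ℕ.* (n C k)          ∎
  where k>n = ℕₚ.≰⇒> k≰n
... | yes k≤n with ℕₚ.m≤n⇒∃[o]m+o≡n k≤n
... | d , refl = ℕₚ.*-cancelʳ-≡ _ _ (k ! ℕ.* d !) {{k ℕₚ.!* d !≢0}} (begin
  suc k ℕ.* c′ ℕ.* (k ! ℕ.* d !)        ≡⟨ regroup (suc k) c′ (k !) (d !) ⟩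
  c′ ℕ.* (suc k ! ℕ.* d !)              ≡⟨ [m+n]Cm*[m!*n!]≡[m+n]! (suc k) d ⟩
  suc (k ℕ.+ d) !                       ≡⟨ cong (suc (k ℕ.+ d) ℕ.*_) ([m+n]Cm*[m!*n!]≡[m+n]! k d) ⟨
  suc (k ℕ.+ d) ℕ.* (c ℕ.* (k ! ℕ.* d !)) ≡⟨ ℕₚ.*-assoc (suc (k ℕ.+ d)) c (k ! ℕ.* d !) ⟨
  suc (k ℕ.+ d) ℕ.* c ℕ.* (k ! ℕ.* d !) ∎)
  where
  c′ = suc (k ℕ.+ d) C suc k
  c = (k ℕ.+ d) C k
  regroup : ∀ s c x y → s ℕ.* c ℕ.* (x ℕ.* y) ≡ c ℕ.* (s ℕ.* x ℕ.* y)
  regroup = ℕ-Solver.solve-∀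

[i+m]Cm*[i+d+m]C[i+m]≡[i+d+m]Cm*[i+d]Ci : ∀ m i d →
  ((i ℕ.+ m) C m) ℕ.* ((i ℕ.+ d ℕ.+ m) C (i ℕ.+ m)) ≡ ((i ℕ.+ d ℕ.+ m) C m) ℕ.* ((i ℕ.+ d) C i)
[i+m]Cm*[i+d+m]C[i+m]≡[i+d+m]Cm*[i+d]Ci m i d =
  ℕₚ.*-cancelʳ-≡ _ _ (m ! ℕ.* (i ! ℕ.* d !)) {{ℕₚ.m*n≢0 (m !) _ {{m ℕₚ.!≢0}} {{i ℕₚ.!* d !≢0}}}}
    (trans left (sym right))
  where
  n = i ℕ.+ d ℕ.+ m
  n≡i+m+d : n ≡ i ℕ.+ m ℕ.+ d
  n≡i+m+d = shuffle i d m
    where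
    shuffle : ∀ i d m → i ℕ.+ d ℕ.+ m ≡ i ℕ.+ m ℕ.+ d
    shuffle = ℕ-Solver.solve-∀
  left : ((i ℕ.+ m) C m) ℕ.* (n C (i ℕ.+ m)) ℕ.* (m ! ℕ.* (i ! ℕ.* d !)) ≡ n !
  left = begin
    ((i ℕ.+ m) C m) ℕ.* (n C (i ℕ.+ m)) ℕ.* (m ! ℕ.* (i ! ℕ.* d !))
      ≡⟨ regroup ((i ℕ.+ m) C m) (n C (i ℕ.+ m)) (m !) (i !) (d !) ⟩
    (n C (i ℕ.+ m)) ℕ.* (((i ℕ.+ m) C m) ℕ.* (i ! ℕ.* m !) ℕ.* d !)
      ≡⟨ cong (λ x → (n C (i ℕ.+ m)) ℕ.* (x ℕ.* d !)) ([m+n]Cn*[m!*n!]≡[m+n]! i m) ⟩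
    (n C (i ℕ.+ m)) ℕ.* ((i ℕ.+ m) ! ℕ.* d !)
      ≡⟨ cong (λ x → (x C (i ℕ.+ m)) ℕ.* ((i ℕ.+ m) ! ℕ.* d !)) n≡i+m+d ⟩
    ((i ℕ.+ m ℕ.+ d) C (i ℕ.+ m)) ℕ.* ((i ℕ.+ m) ! ℕ.* d !)
      ≡⟨ [m+n]Cm*[m!*n!]≡[m+n]! (i ℕ.+ m) d ⟩
    (i ℕ.+ m ℕ.+ d) !
      ≡⟨ cong _! n≡i+m+d ⟨
    n ! ∎
    where
    regroup : ∀ a b x y z → a ℕ.* b ℕ.* (x ℕ.* (y ℕ.* z)) ≡ b ℕ.* (a ℕ.* (y ℕ.* x) ℕ.* z)
    regroup = ℕ-Solver.solve-∀
  right : (n C m) ℕ.* ((i ℕ.+ d) C i) ℕ.* (m ! ℕ.* (i ! ℕ.* d !)) ≡ n !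
  right = begin
    (n C m) ℕ.* ((i ℕ.+ d) C i) ℕ.* (m ! ℕ.* (i ! ℕ.* d !))
      ≡⟨ regroup (n C m) ((i ℕ.+ d) C i) (m !) (i !) (d !) ⟩
    (n C m) ℕ.* (((i ℕ.+ d) C i) ℕ.* (i ! ℕ.* d !) ℕ.* m !)
      ≡⟨ cong (λ x → (n C m) ℕ.* (x ℕ.* m !)) ([m+n]Cm*[m!*n!]≡[m+n]! i d) ⟩
    (n C m) ℕ.* ((i ℕ.+ d) ! ℕ.* m !)
      ≡⟨ [m+n]Cn*[m!*n!]≡[m+n]! (i ℕ.+ d) m ⟩
    n ! ∎
    where
    regroup : ∀ a b x y z → a ℕ.* b ℕ.* (x ℕ.* (y ℕ.* z)) ≡ a ℕ.* (b ℕ.* (y ℕ.* z) ℕ.* x)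
    regroup = ℕ-Solver.solve-∀

ι-[n]Ck≡recip[1+n]*[1+k]*[1+n]C[1+k] : ∀ n k →
  ι (n C k) ≡ recip (suc n) * (ι (suc k) * ι (suc n C suc k))
ι-[n]Ck≡recip[1+n]*[1+k]*[1+n]C[1+k] n k = begin
  ι (n C k)                                       ≡⟨ ℚₚ.*-identityˡ (ι (n C k)) ⟨
  1ℚ * ι (n C k)                                  ≡⟨ cong (_* ι (n C k)) (recip-inverseˡ n) ⟨
  recip (suc n) * ι (suc n) * ι (n C k)           ≡⟨ ℚₚ.*-assoc (recip (suc n)) _ _ ⟩
  recip (suc n) * (ι (suc n) * ι (n C k))         ≡⟨ cong (recip (suc n) *_) (ι-* (suc n) (n C k)) ⟨
  recip (suc n) * ι (suc n ℕ.* (n C k))           ≡⟨ cong (λ x → recip (suc n) * ι x) ([1+k]*[1+n]C[1+k]≡[1+n]*nCk n k) ⟨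
  recip (suc n) * ι (suc k ℕ.* (suc n C suc k))   ≡⟨ cong (recip (suc n) *_) (ι-* (suc k) (suc n C suc k)) ⟩
  recip (suc n) * (ι (suc k) * ι (suc n C suc k)) ∎

alternating-binomial-partial : ∀ n t → Σ< (suc t) (λ i → sgn i * ι (suc n C i)) ≡ sgn t * ι (n C t)
alternating-binomial-partial n zero = refl
alternating-binomial-partial n (suc t) = begin
  Σ< (suc t) (λ i → sgn i * ι (suc n C i)) + sgn (suc t) * ι (suc n C suc t)
    ≡⟨ cong₂ _+_ (alternating-binomial-partial n t)
                 (cong (λ x → - sgn t * ι x) (sym (nCk+nC[k+1]≡[n+1]C[k+1] n t))) ⟩
  sgn t * ι (n C t) + - sgn t * ι (n C t ℕ.+ n C suc t)
    ≡⟨ cong (λ x → sgn t * ι (n C t) + - sgn t * x) (ι-+ (n C t) (n C suc t)) ⟩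
  sgn t * ι (n C t) + - sgn t * (ι (n C t) + ι (n C suc t))
    ≡⟨ telescope (sgn t) (ι (n C t)) (ι (n C suc t)) ⟩
  sgn (suc t) * ι (n C suc t) ∎
  where
  telescope : ∀ s a b → s * a + - s * (a + b) ≡ - s * b
  telescope = solve-∀ ℚ-ring

alternating-binomial-sum : ∀ n → Σ< (suc (suc n)) (λ i → sgn i * ι (suc n C i)) ≡ 0ℚ
alternating-binomial-sum n = begin
  Σ< (suc (suc n)) (λ i → sgn i * ι (suc n C i)) ≡⟨ alternating-binomial-partial n (suc n) ⟩
  sgn (suc n) * ι (n C suc n)                    ≡⟨ cong (λ x → sgn (suc n) * ι x) (k>n⇒nCk≡0 (ℕₚ.n<1+n n)) ⟩
  sgn (suc n) * 0ℚ                               ≡⟨ ℚₚ.*-zeroʳ (sgn (suc n)) ⟩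
  0ℚ                                             ∎

summand : (ℕ → ℚ) → ℕ → ℕ → ℚ → ℚ
summand w m i x = sgn i * ι ((i ℕ.+ m) C m) * x * w (suc (i ℕ.+ m))

T : (ℕ → ℚ) → ℕ → ℕ → ℚ
T w m j = Σ< j (λ i → summand w m i (ι ((j ℕ.+ m) C suc (i ℕ.+ m))))

ΔT : (ℕ → ℚ) → ℕ → ℕ → ℚ
ΔT w m j = Σ< (suc j) (λ i → summand w m i (ι ((j ℕ.+ m) C (i ℕ.+ m))))

T-cong : ∀ w w′ m j → (∀ k → w (suc k) ≡ w′ (suc k)) → T w m j ≡ T w′ m j
T-cong w w′ m j w≡w′ = Σ<-cong j (λ i _ →
  cong (sgn i * ι ((i ℕ.+ m) C m) * ι ((j ℕ.+ m) C suc (i ℕ.+ m)) *_) (w≡w′ (i ℕ.+ m)))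

T-suc : ∀ w m j → T w m (suc j) ≡ T w m j + ΔT w m j
T-suc w m j = begin
  T w m (suc j)                 ≡⟨ Σ<-cong (suc j) (λ i _ → pascal i) ⟩
  Σ< (suc j) (λ i → a i + b i)  ≡⟨ Σ<-+ (suc j) a b ⟩
  ΔT w m j + (T w m j + b j)    ≡⟨ cong (λ x → ΔT w m j + (T w m j + x)) last≡0 ⟩
  ΔT w m j + (T w m j + 0ℚ)     ≡⟨ swap (ΔT w m j) (T w m j) ⟩
  T w m j + ΔT w m j            ∎
  where
  a b : ℕ → ℚ
  a i = summand w m i (ι ((j ℕ.+ m) C (i ℕ.+ m)))
  b i = summand w m i (ι ((j ℕ.+ m) C suc (i ℕ.+ m)))
  distrib : ∀ s c x y v → s * c * (x + y) * v ≡ s * c * x * v + s * c * y * v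
  distrib = solve-∀ ℚ-ring
  pascal : ∀ i → summand w m i (ι (suc (j ℕ.+ m) C suc (i ℕ.+ m))) ≡ a i + b i
  pascal i = trans
    (cong (summand w m i) (trans (cong ι (sym (nCk+nC[k+1]≡[n+1]C[k+1] (j ℕ.+ m) (i ℕ.+ m))))
                                     (ι-+ ((j ℕ.+ m) C (i ℕ.+ m)) ((j ℕ.+ m) C suc (i ℕ.+ m)))))
    (distrib (sgn i) (ι ((i ℕ.+ m) C m)) (ι ((j ℕ.+ m) C (i ℕ.+ m))) (ι ((j ℕ.+ m) C suc (i ℕ.+ m)))
             (w (suc (i ℕ.+ m))))
  annihilate : ∀ s c v → s * c * 0ℚ * v ≡ 0ℚ
  annihilate = solve-∀ ℚ-ring
  last≡0 : b j ≡ 0ℚ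
  last≡0 = trans (cong (summand w m j ∘ ι) (k>n⇒nCk≡0 (ℕₚ.n<1+n (j ℕ.+ m))))
                 (annihilate (sgn j) (ι ((j ℕ.+ m) C m)) (w (suc (j ℕ.+ m))))
  swap : ∀ x y → x + (y + 0ℚ) ≡ y + x
  swap = solve-∀ ℚ-ring

ΔT-absorb : ∀ w m j → ΔT w m j ≡ recip (suc (j ℕ.+ m)) * T (λ k → w k * ι k) m (suc j)
ΔT-absorb w m j = trans (Σ<-cong (suc j) (λ i _ → absorb i)) (Σ<-*ˡ (suc j) r _)
  where
  r = recip (suc (j ℕ.+ m))
  regroup : ∀ s c r k x v → s * c * (r * (k * x)) * v ≡ r * (s * c * x * (v * k))
  regroup = solve-∀ ℚ-ring
  absorb : ∀ i → summand w m i (ι ((j ℕ.+ m) C (i ℕ.+ m)))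
               ≡ r * summand (λ k → w k * ι k) m i (ι (suc (j ℕ.+ m) C suc (i ℕ.+ m)))
  absorb i = trans (cong (summand w m i) (ι-[n]Ck≡recip[1+n]*[1+k]*[1+n]C[1+k] (j ℕ.+ m) (i ℕ.+ m)))
                   (regroup (sgn i) (ι ((i ℕ.+ m) C m)) r (ι (suc (i ℕ.+ m)))
                            (ι (suc (j ℕ.+ m) C suc (i ℕ.+ m))) (w (suc (i ℕ.+ m))))

T-suc-recurrence : ∀ w m j →
  T w m (suc j) ≡ T w m j + recip (suc (j ℕ.+ m)) * T (λ k → w k * ι k) m (suc j)
T-suc-recurrence w m j = trans (T-suc w m j) (cong (_+_ (T w m j)) (ΔT-absorb w m j))

summand-one-revision : ∀ m i d →
  summand (λ _ → 1ℚ) m i (ι ((i ℕ.+ d ℕ.+ m) C (i ℕ.+ m)))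
    ≡ ι ((i ℕ.+ d ℕ.+ m) C m) * (sgn i * ι ((i ℕ.+ d) C i))
summand-one-revision m i d = begin
  sgn i * ι a * ι b * 1ℚ  ≡⟨ regroup (sgn i) (ι a) (ι b) ⟩
  sgn i * (ι a * ι b)     ≡⟨ cong (sgn i *_) (trans (sym (ι-* a b)) (trans (cong ι revision) (ι-* c e))) ⟩
  sgn i * (ι c * ι e)     ≡⟨ regroup′ (sgn i) (ι c) (ι e) ⟩
  ι c * (sgn i * ι e)     ∎
  where
  a = (i ℕ.+ m) C m
  b = (i ℕ.+ d ℕ.+ m) C (i ℕ.+ m)
  c = (i ℕ.+ d ℕ.+ m) C m
  e = (i ℕ.+ d) C i
  revision : a ℕ.* b ≡ c ℕ.* e
  revision = [i+m]Cm*[i+d+m]C[i+m]≡[i+d+m]Cm*[i+d]Ci m i d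
  regroup : ∀ s x y → s * x * y * 1ℚ ≡ s * (x * y)
  regroup = solve-∀ ℚ-ring
  regroup′ : ∀ s x y → s * (x * y) ≡ x * (s * y)
  regroup′ = solve-∀ ℚ-ring

ΔT-one : ∀ m j → ΔT (λ _ → 1ℚ) m j ≡ ι ((j ℕ.+ m) C m) * Σ< (suc j) (λ i → sgn i * ι (j C i))
ΔT-one m j = trans (Σ<-cong (suc j) revise) (Σ<-*ˡ (suc j) (ι ((j ℕ.+ m) C m)) _)
  where
  revise : ∀ i → i < suc j →
    summand (λ _ → 1ℚ) m i (ι ((j ℕ.+ m) C (i ℕ.+ m))) ≡ ι ((j ℕ.+ m) C m) * (sgn i * ι (j C i))
  revise i (s≤s i≤j) =
    let d , i+d≡j = ℕₚ.m≤n⇒∃[o]m+o≡n i≤j in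
    subst (λ j → summand (λ _ → 1ℚ) m i (ι ((j ℕ.+ m) C (i ℕ.+ m)))
                   ≡ ι ((j ℕ.+ m) C m) * (sgn i * ι (j C i)))
          i+d≡j (summand-one-revision m i d)

T-one : ∀ m j → T (λ _ → 1ℚ) m (suc j) ≡ 1ℚ
T-one m zero = begin
  T (λ _ → 1ℚ) m 1          ≡⟨ T-suc (λ _ → 1ℚ) m 0 ⟩
  0ℚ + ΔT (λ _ → 1ℚ) m 0    ≡⟨ ℚₚ.+-identityˡ _ ⟩
  ΔT (λ _ → 1ℚ) m 0         ≡⟨ ΔT-one m 0 ⟩
  ι (m C m) * Σ< 1 (λ i → sgn i * ι (0 C i))
    ≡⟨ cong (λ x → ι x * Σ< 1 (λ i → sgn i * ι (0 C i))) (nCn≡1 m) ⟩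
  ι 1 * Σ< 1 (λ i → sgn i * ι (0 C i))
    ≡⟨⟩
  1ℚ ∎
T-one m (suc j) = begin
  T (λ _ → 1ℚ) m (suc (suc j))
    ≡⟨ T-suc (λ _ → 1ℚ) m (suc j) ⟩
  T (λ _ → 1ℚ) m (suc j) + ΔT (λ _ → 1ℚ) m (suc j)
    ≡⟨ cong₂ _+_ (T-one m j) (ΔT-one m (suc j)) ⟩
  1ℚ + ι ((suc j ℕ.+ m) C m) * Σ< (suc (suc j)) (λ i → sgn i * ι (suc j C i))
    ≡⟨ cong (λ x → 1ℚ + ι ((suc j ℕ.+ m) C m) * x) (alternating-binomial-sum j) ⟩
  1ℚ + ι ((suc j ℕ.+ m) C m) * 0ℚ
    ≡⟨ cong (_+_ 1ℚ) (ℚₚ.*-zeroʳ (ι ((suc j ℕ.+ m) C m))) ⟩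
  1ℚ ∎

T-recip : ∀ m j → T recip m j ≡ H (j ℕ.+ m) + - H m
T-recip m zero    = sym (ℚₚ.+-inverseʳ (H m))
T-recip m (suc j) = begin
  T recip m (suc j)                                    ≡⟨ T-suc-recurrence recip m j ⟩
  T recip m j + r * T (λ k → recip k * ι k) m (suc j)
    ≡⟨ cong₂ (λ x y → x + r * y) (T-recip m j)
             (trans (T-cong (λ k → recip k * ι k) (λ _ → 1ℚ) m (suc j) recip-inverseˡ) (T-one m j)) ⟩
  H N + - H m + r * 1ℚ                                 ≡⟨ rearrange (H N) (H m) r ⟩
  H N + r + - H m                                      ≡⟨ cong (_+ - H m) (H-suc N) ⟨
  H (suc N) + - H m                                    ∎
  where
  N = j ℕ.+ m
  r = recip (suc N)
  rearrange : ∀ x y r → x + - y + r * 1ℚ ≡ x + r + - y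
  rearrange = solve-∀ ℚ-ring

h₂ : ℕ → ℕ → ℚ
h₂ N m = (H N + - H m) * (H N + - H m) * recip 2 + (H^ 2 N + - H^ 2 m) * recip 2

h₂-diagonal : ∀ m → h₂ m m ≡ 0ℚ
h₂-diagonal m = vanish (H m) (H^ 2 m) (recip 2)
  where
  vanish : ∀ a b h → (a + - a) * (a + - a) * h + (b + - b) * h ≡ 0ℚ
  vanish = solve-∀ ℚ-ring

h₂-suc : ∀ N m → h₂ (suc N) m ≡ h₂ N m + recip (suc N) * (H (suc N) + - H m)
h₂-suc N m = begin
  h₂ (suc N) m
    ≡⟨ cong₂ (λ a b → (a + - y) * (a + - y) * ½ + (b + - Y) * ½) (H-suc N) (H²-suc N) ⟩
  (x + u + - y) * (x + u + - y) * ½ + (X + u * u + - Y) * ½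
    ≡⟨ expand x y X Y u ½ ⟩
  h₂ N m + u * (x + u + - y) * (½ + ½)
    ≡⟨⟩
  h₂ N m + u * (x + u + - y) * 1ℚ
    ≡⟨ cong (_+_ (h₂ N m)) (ℚₚ.*-identityʳ (u * (x + u + - y))) ⟩
  h₂ N m + u * (x + u + - y)
    ≡⟨ cong (λ a → h₂ N m + u * (a + - y)) (H-suc N) ⟨
  h₂ N m + u * (H (suc N) + - y)
    ∎
  where
  x = H N
  y = H m
  X = H^ 2 N
  Y = H^ 2 m
  u = recip (suc N)
  ½ = recip 2
  expand : ∀ x y X Y u h → (x + u + - y) * (x + u + - y) * h + (X + u * u + - Y) * h
         ≡ (x + - y) * (x + - y) * h + (X + - Y) * h + u * (x + u + - y) * (h + h)
  expand = solve-∀ ℚ-ring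

recip² : ℕ → ℚ
recip² k = recip (k ^ 2)

recip²-*-ι : ∀ k → recip² (suc k) * ι (suc k) ≡ recip (suc k)
recip²-*-ι k = begin
  recip² (suc k) * ι (suc k)                  ≡⟨ cong (_* ι (suc k)) (recip-square k) ⟩
  recip (suc k) * recip (suc k) * ι (suc k)   ≡⟨ ℚₚ.*-assoc (recip (suc k)) (recip (suc k)) (ι (suc k)) ⟩
  recip (suc k) * (recip (suc k) * ι (suc k)) ≡⟨ cong (recip (suc k) *_) (recip-inverseˡ k) ⟩
  recip (suc k) * 1ℚ                          ≡⟨ ℚₚ.*-identityʳ (recip (suc k)) ⟩
  recip (suc k)                               ∎

T-recip² : ∀ m j → T recip² m j ≡ h₂ (j ℕ.+ m) m
T-recip² m zero    = sym (h₂-diagonal m)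
T-recip² m (suc j) = begin
  T recip² m (suc j)                                     ≡⟨ T-suc-recurrence recip² m j ⟩
  T recip² m j + r * T (λ k → recip² k * ι k) m (suc j)
    ≡⟨ cong₂ (λ x y → x + r * y) (T-recip² m j)
             (trans (T-cong (λ k → recip² k * ι k) recip m (suc j) recip²-*-ι) (T-recip m (suc j))) ⟩
  h₂ N m + r * (H (suc N) + - H m)                       ≡⟨ h₂-suc N m ⟨
  h₂ (suc N) m                                           ∎
  where
  N = j ℕ.+ m
  r = recip (suc N)

lhs-summand : ℕ → ℕ → ℕ → ℚ
lhs-summand n j l = sgn (j ∸ l ∸ 1) * ι ((n ∸ l ∸ 1) C (n ∸ j)) * ι (n C l) * recip ((n ∸ l) ^ 2)

lhs-summand-reversed : ∀ m i o → let j = suc (i ℕ.+ o) in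
  lhs-summand (j ℕ.+ m) j (j ∸ suc i) ≡ summand recip² m i (ι ((j ℕ.+ m) C suc (i ℕ.+ m)))
lhs-summand-reversed m i o = begin
  lhs-summand n j (j ∸ suc i)             ≡⟨ cong (lhs-summand n j) (ℕₚ.m+n∸m≡n i o) ⟩
  term (j ∸ o) (n ∸ o) (n ∸ j) (n C o)    ≡⟨ cong₂ (λ a b → term a b (n ∸ j) (n C o)) j∸o≡1+i n∸o≡1+i+m ⟩
  term (suc i) (suc (i ℕ.+ m)) (n ∸ j) (n C o)
    ≡⟨ cong₂ (term (suc i) (suc (i ℕ.+ m))) (ℕₚ.m+n∸m≡n j m) nCo≡nC[1+i+m] ⟩
  term (suc i) (suc (i ℕ.+ m)) m (n C suc (i ℕ.+ m))  ∎
  where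
  j = suc (i ℕ.+ o)
  n = j ℕ.+ m
  term : ℕ → ℕ → ℕ → ℕ → ℚ
  term a b c e = sgn (a ∸ 1) * ι ((b ∸ 1) C c) * ι e * recip (b ^ 2)
  j∸o≡1+i : j ∸ o ≡ suc i
  j∸o≡1+i = ℕₚ.m+n∸n≡m (suc i) o
  shuffle : ∀ i o m → suc (i ℕ.+ o) ℕ.+ m ≡ suc (i ℕ.+ m) ℕ.+ o
  shuffle = ℕ-Solver.solve-∀
  n∸o≡1+i+m : n ∸ o ≡ suc (i ℕ.+ m)
  n∸o≡1+i+m = trans (cong (_∸ o) (shuffle i o m)) (ℕₚ.m+n∸n≡m (suc (i ℕ.+ m)) o)
  o≤n : o ≤ n
  o≤n = ℕₚ.≤-trans (ℕₚ.m≤n+m o (suc i)) (ℕₚ.m≤m+n j m)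
  nCo≡nC[1+i+m] : n C o ≡ n C suc (i ℕ.+ m)
  nCo≡nC[1+i+m] = trans (nCk≡nC[n∸k] o≤n) (cong (n C_) n∸o≡1+i+m)

lhs≡T : ∀ m j → lhs (j ℕ.+ m) j ≡ T recip² m j
lhs≡T m j = trans (Σ<-reverse j (lhs-summand (j ℕ.+ m) j)) (Σ<-cong j reindex)
  where
  reindex : ∀ i → i < j →
    lhs-summand (j ℕ.+ m) j (j ∸ suc i) ≡ summand recip² m i (ι ((j ℕ.+ m) C suc (i ℕ.+ m)))
  reindex i i<j =
    let o , 1+i+o≡j = ℕₚ.m≤n⇒∃[o]m+o≡n i<j in
    subst (λ j → lhs-summand (j ℕ.+ m) j (j ∸ suc i)
                   ≡ summand recip² m i (ι ((j ℕ.+ m) C suc (i ℕ.+ m))))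
          1+i+o≡j (lhs-summand-reversed m i o)

proposition2 : (n j : ℕ) → 1 ≤ j → j ≤ n → lhs n j ≡ rhs n j
proposition2 n j _ j≤n = subst (λ N → lhs N j ≡ rhs N j) (ℕₚ.m+[n∸m]≡n j≤n) (identity (n ∸ j))
  where
  identity : ∀ m → lhs (j ℕ.+ m) j ≡ rhs (j ℕ.+ m) j
  identity m = begin
    lhs (j ℕ.+ m) j              ≡⟨ lhs≡T m j ⟩
    T recip² m j                 ≡⟨ T-recip² m j ⟩
    h₂ (j ℕ.+ m) m               ≡⟨ cong (h₂ (j ℕ.+ m)) (ℕₚ.m+n∸m≡n j m) ⟨
    h₂ (j ℕ.+ m) (j ℕ.+ m ∸ j)   ≡⟨⟩
    rhs (j ℕ.+ m) j              ∎
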